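{- Let $k$ be a positive integer. Then $SFT(1^k)\subseteq\{0,1\}^{\mathbb{Z}}$ is a maximal $1$-block gluing subshift of order $k$, and $SFT(10^k1)\subseteq\{0,1\}^{\mathbb{Z}}$ is a maximal $1$-block gluing subshift of order $k+2$.
   Context: A subshift is a closed shift-invariant subset of $\{0,1\}^{\mathbb{Z}}$; $L_X$ is its language (finite words occurring in elements of $X$) and $L_X(m)$ the words of length $m$ in it. $X$ is $c$-block gluing if for all $u,v\in L_X$ and every integer $m\geq c$ there is a word $w$ with $|w|=m$ and $uwv\in L_X$. For a word $s$, $SFT(s)$ is the set of configurations in which $s$ does not occur; $1^k$ denotes $k$ consecutive $1$'s and $10^k1$ the word $1$ followed by $k$ zeros followed by $1$. A $c$-block gluing subshift $X$ is maximal of order $n$ if for every $c$-block gluing subshift $Y\subseteq X$ with $L_Y(n)=L_X(n)$ one has $Y=X$. -}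

module Defs where

open import Data.Bool using (Bool; true; false)
open import Data.Nat as ℕ using (ℕ; _≤_)
open import Data.Integer as ℤ using (ℤ; +_)
open import Data.Fin using (Fin; toℕ)
open import Data.List using (List; []; _∷_; _++_; length; replicate; [_]; lookup)
open import Data.Product using (Σ; ∃; _×_; _,_)
open import Relation.Binary.PropositionalEquality using (_≡_)
open import Relation.Nullary using (¬_)
open import Level using (suc; zero)

-- Configurations: elements of {0,1}^ℤ (false = 0, true = 1)
Config : Set
Config = ℤ → Bool

Word : Set
Word = List Bool

Subset : Set₁
Subset = Config → Set

_⊆_ : Subset → Subset → Set
X ⊆ Y = ∀ x → X x → Y x

OccursAt : Word → Config → ℤ → Set
OccursAt w x i = (j : Fin (length w)) → x (i ℤ.+ + toℕ j) ≡ lookup w j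

Occurs : Word → Config → Set
Occurs w x = ∃ λ i → OccursAt w x i

InL : Subset → Word → Set
InL X w = ∃ λ x → X x × Occurs w x

-- closedness in the product topology: if every finite window [-n,n] of x
-- agrees with some element of X, then x ∈ X
IsClosed : Subset → Set
IsClosed X = ∀ x →
  (∀ (n : ℕ) → ∃ λ y → X y × (∀ (i : ℤ) → ℤ.∣ i ∣ ≤ n → y i ≡ x i)) → X x

IsShiftInvariant : Subset → Set
IsShiftInvariant X =
  (∀ x → X x → X (λ i → x (i ℤ.+ + 1))) ×
  (∀ x → X x → X (λ i → x (i ℤ.- + 1)))

IsSubshift : Subset → Set
IsSubshift X = IsClosed X × IsShiftInvariant X

IsBlockGluing : ℕ → Subset → Set
IsBlockGluing c X = ∀ u v → InL X u → InL X v → ∀ (m : ℕ) → c ≤ m →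
  ∃ λ w → length w ≡ m × InL X (u ++ w ++ v)

SameLanguageOfLength : ℕ → Subset → Subset → Set
SameLanguageOfLength n X Y = ∀ w → length w ≡ n →
  (InL X w → InL Y w) × (InL Y w → InL X w)

IsMaximalBlockGluing : ℕ → ℕ → Subset → Set₁
IsMaximalBlockGluing c n X =
  IsSubshift X × IsBlockGluing c X ×
  ((Y : Subset) → IsSubshift Y → IsBlockGluing c Y → Y ⊆ X →
     SameLanguageOfLength n Y X → X ⊆ Y)

SFT : Word → Subset
SFT s x = ¬ Occurs s x

ones : ℕ → Word
ones k = replicate k true

oneZerosOne : ℕ → Word
oneZerosOne k = true ∷ (replicate k false ++ [ true ])

-- Both subshifts are recognised by simple automata (counting trailing 1s,
-- respectively the zeros since the last 1), which makes words of the language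
-- easy to build: zero padding keeps a word accepted, and a gap can always be
-- bridged by 0^m, or by 1^m when 0^m would complete the forbidden word 10^k1.
-- For maximality, a 1-block gluing subshift Y ⊆ X sharing the words of length
-- n must contain a few specific words (1^(k-1) resp. 1 0^k); gluing one of
-- them in front of a shorter word of L_Y forces the glued letter, since the
-- other choice creates the forbidden word. By induction on length, L_X ⊆ L_Y,
-- and a closed shift-invariant Y then contains X.

module Submission where

open import Defs
open import Data.Bool as Bool using (Bool; true; false; not)
open import Data.Bool.Properties using (¬-not)
open import Data.Empty using (⊥-elim)
open import Data.Fin as Fin using (Fin; toℕ; fromℕ<)
import Data.Fin.Properties as Fin
open import Data.Integer as ℤ using (ℤ; +_; -[1+_])
import Data.Integer.Properties as ℤ
open import Data.Integer.Tactic.RingSolver using (solve-∀)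
open import Data.List using ([]; _∷_; _++_; [_]; length; replicate; lookup; applyUpTo; take; drop)
open import Data.List.Properties
  using (length-++; length-++-≤ˡ; length-replicate; length-drop; length-applyUpTo;
         lookup-applyUpTo; take++drop≡id; ++-assoc)
open import Data.Nat as ℕ using (ℕ; zero; suc; _+_; _∸_; _≤_; _<_; _<?_; _≟_; z≤n; s≤s)
open import Data.Nat.Induction using (<-wellFounded)
import Data.Nat.Properties as ℕ
open import Data.Product using (∃; ∃₂; _×_; _,_; proj₁; proj₂)
open import Data.Unit using (⊤; tt)
open import Function.Base using (_∘_; _on_)
open import Induction.WellFounded using (WellFounded; Acc; acc)
import Relation.Binary.Construct.On as On
open import Relation.Binary.PropositionalEquality hiding ([_])
open import Relation.Nullary using (¬_; yes; no)

bit : Word → ℕ → Bool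
bit []      _       = false
bit (c ∷ w) zero    = c
bit (c ∷ w) (suc m) = bit w m

bit-lookup : ∀ w (j : Fin (length w)) → bit w (toℕ j) ≡ lookup w j
bit-lookup (c ∷ w) Fin.zero    = refl
bit-lookup (c ∷ w) (Fin.suc j) = bit-lookup w j

bit-++ˡ : ∀ u v {m} → m < length u → bit (u ++ v) m ≡ bit u m
bit-++ˡ (c ∷ u) v {zero}  _       = refl
bit-++ˡ (c ∷ u) v {suc m} (s≤s p) = bit-++ˡ u v p

bit-++ʳ : ∀ u v m → bit (u ++ v) (length u + m) ≡ bit v m
bit-++ʳ []      v m = refl
bit-++ʳ (c ∷ u) v m = bit-++ʳ u v m

bit-++-zeros : ∀ w N m → bit (w ++ replicate N false) m ≡ bit w m
bit-++-zeros []      zero    m       = refl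
bit-++-zeros []      (suc N) zero    = refl
bit-++-zeros []      (suc N) (suc m) = bit-++-zeros [] N m
bit-++-zeros (c ∷ w) N       zero    = refl
bit-++-zeros (c ∷ w) N       (suc m) = bit-++-zeros w N m

bit-drop : ∀ n w m → bit (drop n w) m ≡ bit w (n + m)
bit-drop zero    w       m = refl
bit-drop (suc n) []      m = refl
bit-drop (suc n) (c ∷ w) m = bit-drop n w m

startsWith : ∀ u w → length u ≤ length w → (∀ j → bit w (toℕ j) ≡ lookup u j) →
             ∃ λ v → w ≡ u ++ v
startsWith []      w       _       _  = w , refl
startsWith (c ∷ u) (d ∷ w) (s≤s p) eq with startsWith u w p (λ j → eq (Fin.suc j))
... | v , refl = v , cong (_∷ u ++ v) (eq Fin.zero)

replicate-+ : ∀ m n (c : Bool) → replicate (m + n) c ≡ replicate m c ++ replicate n c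
replicate-+ zero    n c = refl
replicate-+ (suc m) n c = cong (c ∷_) (replicate-+ m n c)

replicate-snoc : ∀ n (c : Bool) w → replicate n c ++ c ∷ w ≡ c ∷ replicate n c ++ w
replicate-snoc zero    c w = refl
replicate-snoc (suc n) c w = cong (c ∷_) (replicate-snoc n c w)

occursAt⇒bit : ∀ w x i → OccursAt w x i → ∀ m → m < length w → x (i ℤ.+ + m) ≡ bit w m
occursAt⇒bit w x i o m m<∣w∣ =
  subst (λ t → x (i ℤ.+ + t) ≡ bit w t) (Fin.toℕ-fromℕ< m<∣w∣)
    (trans (o j) (sym (bit-lookup w j)))
  where j = fromℕ< m<∣w∣

bit⇒occursAt : ∀ w x i → (∀ m → m < length w → x (i ℤ.+ + m) ≡ bit w m) → OccursAt w x i
bit⇒occursAt w x i eq j = trans (eq (toℕ j) (Fin.toℕ<n j)) (bit-lookup w j)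

InL-prefix : ∀ {X} u v → InL X (u ++ v) → InL X u
InL-prefix u v (x , x∈X , i , o) = x , x∈X , i , bit⇒occursAt u x i λ m m<∣u∣ →
  trans (occursAt⇒bit (u ++ v) x i o m (ℕ.<-≤-trans m<∣u∣ (length-++-≤ˡ u))) (bit-++ˡ u v m<∣u∣)

InL-suffix : ∀ {X} u v → InL X (u ++ v) → InL X v
InL-suffix u v (x , x∈X , i , o) =
  x , x∈X , i ℤ.+ + length u , bit⇒occursAt v x (i ℤ.+ + length u) reads-v
  where
  open ≡-Reasoning
  reads-v : ∀ m → m < length v → x (i ℤ.+ + length u ℤ.+ + m) ≡ bit v m
  reads-v m m<∣v∣ = begin
    x (i ℤ.+ + length u ℤ.+ + m)  ≡⟨ cong x (ℤ.+-assoc i (+ length u) (+ m)) ⟩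
    x (i ℤ.+ + (length u + m))    ≡⟨ occursAt⇒bit (u ++ v) x i o (length u + m) ∣u∣+m<∣uv∣ ⟩
    bit (u ++ v) (length u + m)   ≡⟨ bit-++ʳ u v m ⟩
    bit v m                       ∎
    where
    ∣u∣+m<∣uv∣ = subst (length u + m <_) (sym (length-++ u)) (ℕ.+-monoʳ-< (length u) m<∣v∣)

InL-suffix-∷ : ∀ {X} u c v → InL X (u ++ c ∷ v) → InL X v
InL-suffix-∷ {X} u c v h = InL-suffix (u ++ [ c ]) v (subst (InL X) (sym (++-assoc u [ c ] v)) h)

InL-mono : ∀ {X Y} → Y ⊆ X → ∀ w → InL Y w → InL X w
InL-mono Y⊆X w (y , y∈Y , o) = y , Y⊆X y y∈Y , o

SFT-forbids : ∀ F v → ¬ InL (SFT F) (F ++ v)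
SFT-forbids F v h with InL-prefix F v h
... | x , x∈SFT , occ = x∈SFT occ

SFT-isClosed : ∀ F → IsClosed (SFT F)
SFT-isClosed F x approx (i , o) with approx (ℤ.∣ i ∣ + length F)
... | y , y∈SFT , agree = y∈SFT (i , λ j → trans (agree (i ℤ.+ + toℕ j) (near j)) (o j))
  where
  near : ∀ j → ℤ.∣ i ℤ.+ + toℕ j ∣ ≤ ℤ.∣ i ∣ + length F
  near j = ℕ.≤-trans (ℤ.∣i+j∣≤∣i∣+∣j∣ i (+ toℕ j)) (ℕ.+-monoʳ-≤ ℤ.∣ i ∣ (ℕ.<⇒≤ (Fin.toℕ<n j)))

SFT-isShiftInvariant : ∀ F → IsShiftInvariant (SFT F)
SFT-isShiftInvariant F =
  (λ x x∈SFT (i , o) → x∈SFT (i ℤ.+ + 1 , λ j → trans (cong x (+1-comm i (+ toℕ j))) (o j))) ,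
  (λ x x∈SFT (i , o) → x∈SFT (i ℤ.- + 1 , λ j → trans (cong x (-1-comm i (+ toℕ j))) (o j)))
  where
  +1-comm : ∀ i a → i ℤ.+ + 1 ℤ.+ a ≡ i ℤ.+ a ℤ.+ + 1
  +1-comm = solve-∀
  -1-comm : ∀ i a → i ℤ.- + 1 ℤ.+ a ≡ i ℤ.+ a ℤ.- + 1
  -1-comm = solve-∀

SFT-isSubshift : ∀ F → IsSubshift (SFT F)
SFT-isSubshift F = SFT-isClosed F , SFT-isShiftInvariant F

readFrom : Config → ℤ → ℕ → Bool
readFrom x i m = x (i ℤ.+ + m)

window : Config → ℕ → Word
window x n = applyUpTo (readFrom x (ℤ.- + n)) (suc (n + n))

window-occurs : ∀ x n → OccursAt (window x n) x (ℤ.- + n)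
window-occurs x n j = sym (lookup-applyUpTo (readFrom x (ℤ.- + n)) (suc (n + n)) j)

reads-window : ∀ x n y i → OccursAt (window x n) y i →
               ∀ m → m ≤ n + n → y (i ℤ.+ + m) ≡ x (ℤ.- + n ℤ.+ + m)
reads-window x n y i o m m≤2n =
  subst (λ t → y (i ℤ.+ + t) ≡ x (ℤ.- + n ℤ.+ + t)) (Fin.toℕ-fromℕ< m<∣W∣)
    (trans (o j) (lookup-applyUpTo (readFrom x (ℤ.- + n)) (suc (n + n)) j))
  where
  m<∣W∣ = subst (m <_) (sym (length-applyUpTo (readFrom x (ℤ.- + n)) (suc (n + n)))) (s≤s m≤2n)
  j = fromℕ< m<∣W∣

∣i∣≤n⇒i+n≡+m : ∀ {n} i → ℤ.∣ i ∣ ≤ n → ∃ λ m → i ℤ.+ + n ≡ + m × m ≤ n + n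
∣i∣≤n⇒i+n≡+m {n} (+ a)    a≤n = a + n , refl , ℕ.+-monoˡ-≤ n a≤n
∣i∣≤n⇒i+n≡+m {n} -[1+ a ] a<n = n ∸ suc a , ℤ.⊖-≥ a<n , ℕ.≤-trans (ℕ.m∸n≤m n (suc a)) (ℕ.m≤m+n n n)

module _ {Y : Subset} (Y-subshift : IsSubshift Y) where
  private
    closed = proj₁ Y-subshift
    σ      = proj₁ (proj₂ Y-subshift)
    σ⁻¹    = proj₂ (proj₂ Y-subshift)

  ≗-closed : ∀ {y z} → Y y → (∀ i → y i ≡ z i) → Y z
  ≗-closed {y} {z} y∈Y y≗z = closed z (λ _ → y , y∈Y , λ i _ → y≗z i)

  shift-closed : ∀ d {y} → Y y → Y (λ i → y (i ℤ.+ d))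
  shift-closed (+ zero)      {y} y∈Y = ≗-closed y∈Y (λ i → cong y (sym (ℤ.+-identityʳ i)))
  shift-closed (+ suc n)     {y} y∈Y =
    ≗-closed (σ _ (shift-closed (+ n) y∈Y)) (λ i → cong y (ℤ.+-assoc i (+ 1) (+ n)))
  shift-closed -[1+ zero ]   {y} y∈Y = σ⁻¹ y y∈Y
  shift-closed -[1+ suc n ]  {y} y∈Y =
    ≗-closed (σ⁻¹ _ (shift-closed -[1+ n ] y∈Y)) (λ i → cong y (ℤ.+-assoc i -[1+ 0 ] -[1+ n ]))

  -- x is approximated on [-n, n] by a shift of any y ∈ Y in which the window of x around 0 occurs.
  ⊆-fromLanguage : ∀ {X} → (∀ w → InL X w → InL Y w) → X ⊆ Y
  ⊆-fromLanguage L⊆ x x∈X = closed x approx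
    where
    approx : ∀ n → ∃ λ y → Y y × (∀ t → ℤ.∣ t ∣ ≤ n → y t ≡ x t)
    approx n with L⊆ (window x n) (x , x∈X , ℤ.- + n , window-occurs x n)
    ... | y , y∈Y , i , o = (λ t → y (t ℤ.+ (i ℤ.+ + n))) , shift-closed (i ℤ.+ + n) y∈Y , agree
      where
      open ≡-Reasoning
      reassoc : ∀ t i n → t ℤ.+ (i ℤ.+ n) ≡ i ℤ.+ (t ℤ.+ n)
      reassoc = solve-∀
      cancel : ∀ t n → ℤ.- n ℤ.+ (t ℤ.+ n) ≡ t
      cancel = solve-∀
      agree : ∀ t → ℤ.∣ t ∣ ≤ n → y (t ℤ.+ (i ℤ.+ + n)) ≡ x t
      agree t ∣t∣≤n with ∣i∣≤n⇒i+n≡+m t ∣t∣≤n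
      ... | m , t+n≡m , m≤2n = begin
        y (t ℤ.+ (i ℤ.+ + n))       ≡⟨ cong y (trans (reassoc t i (+ n)) (cong (ℤ._+_ i) t+n≡m)) ⟩
        y (i ℤ.+ + m)               ≡⟨ reads-window x n y i o m m≤2n ⟩
        x (ℤ.- + n ℤ.+ + m)         ≡⟨ cong (x ∘ ℤ._+_ (ℤ.- + n)) t+n≡m ⟨
        x (ℤ.- + n ℤ.+ (t ℤ.+ + n)) ≡⟨ cong x (cancel t (+ n)) ⟩
        x t                         ∎

zeroPadded : Word → Config
zeroPadded w (+ n)    = bit w n
zeroPadded w -[1+ n ] = false

zeroPadded-occurs : ∀ w → OccursAt w (zeroPadded w) (+ 0)
zeroPadded-occurs w = bit⇒occursAt w (zeroPadded w) (+ 0) (λ _ _ → refl)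

reads⇒factor : ∀ u w n → (∀ j → bit w (n + toℕ j) ≡ lookup u j) →
                  ∃₂ λ a b → w ++ replicate (n + length u) false ≡ a ++ u ++ b
reads⇒factor u w n reads =
  take n z , proj₁ split , trans (sym (take++drop≡id n z)) (cong (take n z ++_) (proj₂ split))
  where
  z = w ++ replicate (n + length u) false
  ∣u∣≤∣drop-n-z∣ : length u ≤ length (drop n z)
  ∣u∣≤∣drop-n-z∣ rewrite length-drop n z | length-++ w {replicate (n + length u) false}
                       | length-replicate (n + length u) {false}
    = ℕ.≤-trans (ℕ.≤-reflexive (sym (ℕ.m+n∸m≡n n (length u))))
                (ℕ.∸-monoˡ-≤ n (ℕ.m≤n+m (n + length u) (length w)))
  split = startsWith u (drop n z) ∣u∣≤∣drop-n-z∣ λ j →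
    trans (bit-drop n z (toℕ j)) (trans (bit-++-zeros w _ (n + toℕ j)) (reads j))

-- A word starting with 1 cannot begin at a negative position.
zeroPadded-factor : ∀ F' w {i} → OccursAt (true ∷ F') (zeroPadded w) i →
                    ∃ λ N → ∃₂ λ a b → w ++ replicate N false ≡ a ++ (true ∷ F') ++ b
zeroPadded-factor F' w {+ n}      o = _ , reads⇒factor (true ∷ F') w n o
zeroPadded-factor F' w { -[1+ n ]} o with o Fin.zero
... | ()

glue-forced : ∀ {Y} → IsBlockGluing 1 Y → ∀ u v c → InL Y u → InL Y v →
              ¬ InL Y (u ++ not c ∷ v) → InL Y (u ++ c ∷ v)
glue-forced glue u v c u∈L v∈L ¬other with glue u v u∈L v∈L 1 ℕ.≤-refl
... | b ∷ [] , _ , glued with b Bool.≟ c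
...   | yes refl = glued
...   | no b≢c   = ⊥-elim (¬other (subst (λ d → InL _ (u ++ d ∷ v)) (¬-not b≢c) glued))

data LeadingRun (c : Bool) (k : ℕ) : Word → Set where
  long  : ∀ v → LeadingRun c k (replicate k c ++ c ∷ v)
  whole : ∀ {q} → q ≤ k → LeadingRun c k (replicate q c)
  ended : ∀ {q} → q ≤ k → ∀ v → LeadingRun c k (replicate q c ++ not c ∷ v)

leadingRun : ∀ c k w → LeadingRun c k w
leadingRun c k       []      = whole z≤n
leadingRun c k       (d ∷ w) with d Bool.≟ c
leadingRun c k       (d ∷ w) | no d≢c rewrite ¬-not d≢c = ended z≤n w
leadingRun c zero    (c ∷ w) | yes refl = long w
leadingRun c (suc k) (c ∷ w) | yes refl with leadingRun c k w
... | long v      = long v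
... | whole q≤k   = whole (s≤s q≤k)
... | ended q≤k v = ended (s≤s q≤k) v

InL-run-prefix : ∀ {X} u {q n} c → q ≤ n → InL X (u ++ replicate n c) → InL X (u ++ replicate q c)
InL-run-prefix {X} u {q} c q≤n h with ℕ.m≤n⇒∃[o]m+o≡n q≤n
... | o , refl = InL-prefix (u ++ replicate q c) (replicate o c)
  (subst (InL X) (trans (cong (u ++_) (replicate-+ q o c)) (sym (++-assoc u (replicate q c) _))) h)

InL-run-suffix : ∀ {X} {q n} c w → q ≤ n → InL X (replicate n c ++ w) → InL X (replicate q c ++ w)
InL-run-suffix {X} {q} c w q≤n h with ℕ.m≤n⇒∃[o]m+o≡n q≤n
... | o , refl = InL-suffix (replicate o c) (replicate q c ++ w)
  (subst (InL X) (trans (cong (λ t → replicate t c ++ w) (ℕ.+-comm q o))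
                        (trans (cong (_++ w) (replicate-+ o q c)) (++-assoc (replicate o c) _ w))) h)

shorter-than-++-∷ : ∀ u (c : Bool) v → length v < length (u ++ c ∷ v)
shorter-than-++-∷ u c v =
  subst (length v <_) (sym (length-++ u)) (ℕ.m≤n+m (suc (length v)) (length u))

shorter-wellFounded : WellFounded (_<_ on length {A = Bool})
shorter-wellFounded = On.wellFounded length <-wellFounded

module Automaton (δ : ℕ → Bool → ℕ) (Allowed : ℕ → Set) where

  Accepts : ℕ → Word → Set
  Accepts q []          = ⊤
  Accepts q (false ∷ w) = Accepts (δ q false) w
  Accepts q (true ∷ w)  = Allowed q × Accepts (δ q true) w

  run : ℕ → Word → ℕ
  run q []      = q
  run q (c ∷ w) = run (δ q c) w

  Accepts-++ : ∀ q u {v} → Accepts q u → Accepts (run q u) v → Accepts q (u ++ v)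
  Accepts-++ q []          _        b = b
  Accepts-++ q (false ∷ u) a        b = Accepts-++ _ u a b
  Accepts-++ q (true ∷ u)  (ok , a) b = ok , Accepts-++ _ u a b

  Accepts-++⁻ˡ : ∀ q u {v} → Accepts q (u ++ v) → Accepts q u
  Accepts-++⁻ˡ q []          _        = tt
  Accepts-++⁻ˡ q (false ∷ u) a        = Accepts-++⁻ˡ _ u a
  Accepts-++⁻ˡ q (true ∷ u)  (ok , a) = ok , Accepts-++⁻ˡ _ u a

  Accepts-++⁻ʳ : ∀ q u {v} → Accepts q (u ++ v) → Accepts (run q u) v
  Accepts-++⁻ʳ q []          a       = a
  Accepts-++⁻ʳ q (false ∷ u) a       = Accepts-++⁻ʳ _ u a
  Accepts-++⁻ʳ q (true ∷ u)  (_ , a) = Accepts-++⁻ʳ _ u a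

  Accepts-zeros : ∀ q N → Accepts q (replicate N false)
  Accepts-zeros q zero    = tt
  Accepts-zeros q (suc N) = Accepts-zeros _ N

  -- Zero padding keeps a word accepted, so it cannot create an occurrence of a rejected word.
  Accepts⇒InL-SFT : ∀ {F'} → (∀ q → ¬ Accepts q (true ∷ F')) →
                    ∀ q w → Accepts q w → InL (SFT (true ∷ F')) w
  Accepts⇒InL-SFT {F'} rejects q w accepted = zeroPadded w , avoids , + 0 , zeroPadded-occurs w
    where
    avoids : SFT (true ∷ F') (zeroPadded w)
    avoids (i , o) with zeroPadded-factor F' w {i} o
    ... | N , a , b , padded≡aFb = rejects _ (Accepts-++⁻ˡ _ (true ∷ F') (Accepts-++⁻ʳ q a
            (subst (Accepts q) padded≡aFb (Accepts-++ q w accepted (Accepts-zeros _ N)))))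

module OnesSFT (k' : ℕ) where
  private
    K = suc k'
    F = ones K
    X = SFT F

  trailingOnes : ℕ → Bool → ℕ
  trailingOnes r false = 0
  trailingOnes r true  = suc r

  open Automaton trailingOnes (λ r → suc r < K)

  ones-rejected : ∀ r j → K ≤ r + suc j → ¬ Accepts r (replicate (suc j) true)
  ones-rejected r zero    K≤r+1 (r+1<K , _) = ℕ.<⇒≱ r+1<K (subst (K ≤_) (ℕ.+-comm r 1) K≤r+1)
  ones-rejected r (suc j) K≤    (_ , a)     =
    ones-rejected (suc r) j (subst (K ≤_) (ℕ.+-suc r (suc j)) K≤) a

  ones-accepted : ∀ r j → r + j < K → Accepts r (replicate j true)
  ones-accepted r zero    _       = tt
  ones-accepted r (suc j) r+j+1<K =
    ℕ.≤-<-trans (ℕ.m≤m+n (suc r) j) r+1+j<K , ones-accepted (suc r) j r+1+j<K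
    where r+1+j<K = subst (_< K) (ℕ.+-suc r j) r+j+1<K

  accepted-after : ∀ r z → r < K → InL X (replicate r true ++ z) → Accepts r z
  accepted-after r []          _   _ = tt
  accepted-after r (false ∷ z) _   h =
    accepted-after 0 z (s≤s z≤n) (InL-suffix-∷ (replicate r true) false z h)
  accepted-after r (true ∷ z)  r<K h with suc r <? K
  ... | yes r+1<K = r+1<K , accepted-after (suc r) z r+1<K (subst (InL X) (replicate-snoc r true z) h)
  ... | no  r+1≮K = ⊥-elim (SFT-forbids F z (subst (InL X) F-prefix h))
    where
    F-prefix : replicate r true ++ true ∷ z ≡ F ++ z
    F-prefix = trans (replicate-snoc r true z)
                     (cong (λ t → replicate t true ++ z) (ℕ.≤-antisym r<K (ℕ.≮⇒≥ r+1≮K)))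

  InL⇒Accepts : ∀ w → InL X w → Accepts 0 w
  InL⇒Accepts w = accepted-after 0 w (s≤s z≤n)

  Accepts⇒InL : ∀ w → Accepts 0 w → InL X w
  Accepts⇒InL w = Accepts⇒InL-SFT (λ q → ones-rejected q k' (ℕ.m≤n+m K q)) 0 w

  zeros-reset : ∀ q m {v} → Accepts 0 v → Accepts q (replicate (suc m) false ++ v)
  zeros-reset q zero    a = a
  zeros-reset q (suc m) a = zeros-reset 0 m a

  isBlockGluing : IsBlockGluing 1 X
  isBlockGluing u v u∈L v∈L (suc m) _ = replicate (suc m) false , length-replicate (suc m) ,
    Accepts⇒InL (u ++ replicate (suc m) false ++ v)
      (Accepts-++ 0 u (InL⇒Accepts u u∈L) (zeros-reset (run 0 u) m (InL⇒Accepts v v∈L)))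

  isMaximal : ∀ Y → IsSubshift Y → IsBlockGluing 1 Y → Y ⊆ X →
              SameLanguageOfLength K Y X → X ⊆ Y
  isMaximal Y Y-subshift Y-glue Y⊆X same =
    ⊆-fromLanguage Y-subshift (λ w → inY w (shorter-wellFounded w))
    where
    W : Word
    W = replicate k' true ++ [ false ]

    W∈Y : InL Y W
    W∈Y = proj₂ (same W ∣W∣≡K)
      (Accepts⇒InL W (Accepts-++ 0 (replicate k' true) (ones-accepted 0 k' ℕ.≤-refl) tt))
      where
      ∣W∣≡K = trans (length-++ (replicate k' true))
                    (trans (cong (_+ 1) (length-replicate k')) (ℕ.+-comm k' 1))

    ones∈Y : ∀ {q} → q ≤ k' → InL Y (replicate q true)
    ones∈Y q≤k' = InL-run-prefix [] true q≤k' (InL-prefix (replicate k' true) [ false ] W∈Y)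

    inY : ∀ w → Acc (_<_ on length) w → InL X w → InL Y w
    inY w (acc shorter) w∈X with leadingRun true k' w
    ... | long v       = ⊥-elim (SFT-forbids F v (subst (InL X) (replicate-snoc k' true v) w∈X))
    ... | whole q≤k'   = ones∈Y q≤k'
    ... | ended {q} q≤k' v = InL-run-suffix true (false ∷ v) q≤k'
      (glue-forced Y-glue (replicate k' true) v false (ones∈Y ℕ.≤-refl) v∈Y ¬ones-true-v)
      where
      v∈Y : InL Y v
      v∈Y = inY v (shorter (shorter-than-++-∷ (replicate q true) false v))
                  (InL-suffix-∷ (replicate q true) false v w∈X)
      ¬ones-true-v : ¬ InL Y (replicate k' true ++ true ∷ v)
      ¬ones-true-v h = SFT-forbids F v (subst (InL X) (replicate-snoc k' true v)
                                              (InL-mono Y⊆X (replicate k' true ++ true ∷ v) h))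

  isMaximalBlockGluing : IsMaximalBlockGluing 1 K X
  isMaximalBlockGluing = SFT-isSubshift F , isBlockGluing , isMaximal

module GapSFT (k' : ℕ) where
  private
    k = suc k'
    F = oneZerosOne k
    X = SFT F

  -- State 0: no 1 read yet; state suc d: the last 1 read is followed by d zeros.
  sinceLastOne : ℕ → Bool → ℕ
  sinceLastOne q       true  = 1
  sinceLastOne zero    false = zero
  sinceLastOne (suc d) false = suc (suc d)

  open Automaton sinceLastOne (λ q → q ≢ suc k)

  F-++ : ∀ v → true ∷ replicate k false ++ true ∷ v ≡ F ++ v
  F-++ v = cong (true ∷_) (sym (++-assoc (replicate k false) [ true ] v))

  gap-rejected : ∀ d j → d + j ≡ k → ¬ Accepts (suc d) (replicate j false ++ [ true ])
  gap-rejected d zero    d+0≡k   (d≢k , _) = d≢k (cong suc (trans (sym (ℕ.+-identityʳ d)) d+0≡k))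
  gap-rejected d (suc j) d+j+1≡k a         =
    gap-rejected (suc d) j (trans (sym (ℕ.+-suc d j)) d+j+1≡k) a

  zeros-from : ∀ d n {v} → Accepts (suc (d + n)) v → Accepts (suc d) (replicate n false ++ v)
  zeros-from d zero    {v} a = subst (λ q → Accepts (suc q) v) (ℕ.+-identityʳ d) a
  zeros-from d (suc n) {v} a =
    zeros-from (suc d) n (subst (λ q → Accepts (suc q) v) (ℕ.+-suc d n) a)

  zeros-from-0 : ∀ n {v} → Accepts 0 v → Accepts 0 (replicate n false ++ v)
  zeros-from-0 zero    a = a
  zeros-from-0 (suc n) a = zeros-from-0 n a

  zeros-from-0⁻ : ∀ n {v} → Accepts 0 (replicate n false ++ v) → Accepts 0 v
  zeros-from-0⁻ zero    a = a
  zeros-from-0⁻ (suc n) a = zeros-from-0⁻ n a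

  ones-from-1 : ∀ j {v} → Accepts 1 v → Accepts 1 (replicate j true ++ v)
  ones-from-1 zero    a = a
  ones-from-1 (suc j) a = (λ ()) , ones-from-1 j a

  -- Once more than k zeros follow the last 1, the automaton behaves as in its initial state.
  far-accepts : ∀ {d} → k < d → ∀ v → Accepts 0 v → Accepts (suc d) v
  far-accepts k<d []          _       = tt
  far-accepts k<d (false ∷ v) a       = far-accepts (ℕ.m<n⇒m<1+n k<d) v a
  far-accepts k<d (true ∷ v)  (_ , a) = (λ d+1≡k+1 → ℕ.<⇒≢ k<d (sym (ℕ.suc-injective d+1≡k+1))) , a

  stateWord : ℕ → Word
  stateWord zero    = []
  stateWord (suc d) = true ∷ replicate d false

  accepted-after : ∀ q z → InL X (stateWord q ++ z) → Accepts q z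
  accepted-after q       []          _ = tt
  accepted-after zero    (false ∷ z) h = accepted-after 0 z (InL-suffix [ false ] z h)
  accepted-after (suc d) (false ∷ z) h =
    accepted-after (suc (suc d)) z (subst (InL X) (cong (true ∷_) (replicate-snoc d false z)) h)
  accepted-after q       (true ∷ z)  h =
    (λ { refl → SFT-forbids F z (subst (InL X) (F-++ z) h) }) ,
    accepted-after 1 z (InL-suffix (stateWord q) (true ∷ z) h)

  InL⇒Accepts : ∀ w → InL X w → Accepts 0 w
  InL⇒Accepts = accepted-after 0

  Accepts⇒InL : ∀ w → Accepts 0 w → InL X w
  Accepts⇒InL = Accepts⇒InL-SFT (λ _ (_ , a) → gap-rejected 0 k refl a) 0

  0<d+m+1 : ∀ d m → 0 < d + suc m
  0<d+m+1 d m = ℕ.<-≤-trans (s≤s z≤n) (ℕ.m≤n+m (suc m) d)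

  -- Fill with zeros, unless that creates the forbidden gap; then fill with ones.
  bridge : ∀ q m v → Accepts 0 v → ∃ λ w → length w ≡ suc m × Accepts q (w ++ v)
  bridge zero    m v a = replicate (suc m) false , length-replicate (suc m) , zeros-from-0 (suc m) a
  bridge (suc d) m v a with leadingRun false k v
  ... | long V = replicate (suc m) false , length-replicate (suc m) ,
    zeros-from d (suc m) (zeros-from (d + suc m) k
      (far-accepts (ℕ.m<n+m k (0<d+m+1 d m)) (false ∷ V) (zeros-from-0⁻ k a)))
  ... | whole {q} _ = replicate (suc m) false , length-replicate (suc m) ,
    zeros-from d (suc m) (Accepts-zeros _ q)
  ... | ended {q} _ R with zeros-from-0⁻ q a | d + suc m + q ≟ k
  ...   | (_ , R-accepted) | no gap≢k = replicate (suc m) false , length-replicate (suc m) ,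
    zeros-from d (suc m) (zeros-from (d + suc m) q ((gap≢k ∘ ℕ.suc-injective) , R-accepted))
  ...   | (_ , R-accepted) | yes gap≡k = replicate (suc m) true , length-replicate (suc m) ,
    (d≢k ∘ ℕ.suc-injective) , ones-from-1 m (zeros-from 0 q ((q≢k ∘ ℕ.suc-injective) , R-accepted))
    where
    d≢k : d ≢ k
    d≢k = ℕ.<⇒≢ (ℕ.<-≤-trans (ℕ.m<m+n d (s≤s z≤n))
                             (ℕ.≤-trans (ℕ.m≤m+n (d + suc m) q) (ℕ.≤-reflexive gap≡k)))
    q≢k : q ≢ k
    q≢k = ℕ.<⇒≢ (ℕ.<-≤-trans (ℕ.m<n+m q (0<d+m+1 d m)) (ℕ.≤-reflexive gap≡k))

  isBlockGluing : IsBlockGluing 1 X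
  isBlockGluing u v u∈L v∈L (suc m) _ with bridge (run 0 u) m v (InL⇒Accepts v v∈L)
  ... | w , ∣w∣≡m+1 , a =
    w , ∣w∣≡m+1 , Accepts⇒InL (u ++ w ++ v) (Accepts-++ 0 u (InL⇒Accepts u u∈L) a)

  isMaximal : ∀ Y → IsSubshift Y → IsBlockGluing 1 Y → Y ⊆ X →
              SameLanguageOfLength (k + 2) Y X → X ⊆ Y
  isMaximal Y Y-subshift Y-glue Y⊆X same =
    ⊆-fromLanguage Y-subshift (λ w → inY w (shorter-wellFounded w))
    where
    W : Word
    W = true ∷ replicate (suc k) false

    W∈Y : InL Y W
    W∈Y = proj₂ (same W ∣W∣≡k+2) (Accepts⇒InL W ((λ ()) , Accepts-zeros 1 (suc k)))
      where ∣W∣≡k+2 = trans (cong (suc ∘ suc) (length-replicate k)) (ℕ.+-comm 2 k)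

    gap∈Y : ∀ {q} → q ≤ suc k → InL Y (true ∷ replicate q false)
    gap∈Y q≤k+1 = InL-run-prefix [ true ] false q≤k+1 W∈Y

    U : Word
    U = true ∷ replicate k false

    ¬U-true : ∀ v → ¬ InL Y (U ++ true ∷ v)
    ¬U-true v h = SFT-forbids F v (subst (InL X) (F-++ v) (InL-mono Y⊆X (U ++ true ∷ v) h))

    inY : ∀ w → Acc (_<_ on length) w → InL X w → InL Y w
    inY []          _             _ = InL-prefix [] W W∈Y
    inY (false ∷ w) (acc shorter) h = InL-suffix U (false ∷ w)
      (glue-forced Y-glue U w false (gap∈Y (ℕ.n≤1+n k))
        (inY w (shorter ℕ.≤-refl) (InL-suffix [ false ] w h)) (¬U-true w))
    inY (true ∷ w)  (acc shorter) h with leadingRun false k w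
    ... | long v = glue-forced Y-glue U v false (gap∈Y (ℕ.n≤1+n k))
      (inY v (shorter (shorter-than-++-∷ U false v)) (InL-suffix-∷ U false v h)) (¬U-true v)
    ... | whole q≤k = gap∈Y (ℕ.m≤n⇒m≤1+n q≤k)
    ... | ended {q} q≤k R with q ≟ k
    ...   | yes refl = ⊥-elim (SFT-forbids F R (subst (InL X) (F-++ R) h))
    ...   | no  q≢k  = InL-suffix V (true ∷ w)
      (glue-forced Y-glue V w true (gap∈Y r≤k+1)
        (inY w (shorter ℕ.≤-refl) (InL-suffix [ true ] w h)) ¬V-false)
      where
      r = proj₁ (ℕ.m≤n⇒∃[o]m+o≡n (ℕ.≤∧≢⇒< q≤k q≢k))
      q+1+r≡k = proj₂ (ℕ.m≤n⇒∃[o]m+o≡n (ℕ.≤∧≢⇒< q≤k q≢k))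
      r≤k+1 : r ≤ suc k
      r≤k+1 = ℕ.≤-trans (ℕ.m≤n+m r (suc q)) (ℕ.≤-trans (ℕ.≤-reflexive q+1+r≡k) (ℕ.n≤1+n k))
      V : Word
      V = true ∷ replicate r false
      ¬V-false : ¬ InL Y (V ++ false ∷ w)
      ¬V-false = subst (λ t → ¬ InL Y t) (cong (true ∷_) (sym gap)) (¬U-true R)
        where
        open ≡-Reasoning
        gap : replicate r false ++ false ∷ replicate q false ++ true ∷ R ≡
              replicate k false ++ true ∷ R
        gap = begin
          replicate r false ++ replicate (suc q) false ++ true ∷ R
            ≡⟨ ++-assoc (replicate r false) _ _ ⟨
          (replicate r false ++ replicate (suc q) false) ++ true ∷ R
            ≡⟨ cong (_++ true ∷ R) (replicate-+ r (suc q) false) ⟨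
          replicate (r + suc q) false ++ true ∷ R
            ≡⟨ cong (λ t → replicate t false ++ true ∷ R) (trans (ℕ.+-comm r (suc q)) q+1+r≡k) ⟩
          replicate k false ++ true ∷ R
            ∎

  isMaximalBlockGluing : IsMaximalBlockGluing 1 (k + 2) X
  isMaximalBlockGluing = SFT-isSubshift F , isBlockGluing , isMaximal

mainTheorem14 : (k : ℕ) → 1 ≤ k →
    IsMaximalBlockGluing 1 k (SFT (ones k)) ×
    IsMaximalBlockGluing 1 (k + 2) (SFT (oneZerosOne k))
mainTheorem14 (suc k') _ = OnesSFT.isMaximalBlockGluing k' , GapSFT.isMaximalBlockGluing k'
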